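{- Let $u,v$ be words and $x$ a letter such that the concatenation $uxv$ is a permutation (all letters distinct). Then $\mathrm{iDes}(uxv)=\mathrm{iDes}(ux\gamma_x(v))$.
   Context: For a permutation (word with distinct letters $1,\ldots,n$) $w$, $i<n$ is an inverse descent if $i+1$ lies to the left of $i$ in $w$; $\mathrm{iDes}(w)$ is the set of inverse descents. For a word $v=v_1\cdots v_m$ with distinct letters and a letter $x$ not in $v$, define the partitioning $\Gamma_x(v)$ into consecutive blocks: if $v_1<x$, break $v$ immediately before each index $j$ with $v_j<x$; otherwise break before each index $j$ with $v_j>x$. Then $\gamma_x(v)$ is obtained by moving the first letter of each block to the end of that block. (Example: $\Gamma_5(83691724)=|83|6|91|724$ and $\gamma_5(83691724)=38619247$.) -}

module Defs where

open import Data.Nat using (ℕ; zero; suc; _<ᵇ_; _≡ᵇ_; _∸_)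
open import Data.Bool using (Bool; true; false; if_then_else_; _∧_)
open import Data.List using (List; []; _∷_; _++_; [_]; length; filterᵇ; upTo; map)
open import Data.List.Relation.Binary.Permutation.Propositional using (_↭_)
open import Relation.Binary.PropositionalEquality using (_≡_)

_==ᴮ_ : Bool → Bool → Bool
true ==ᴮ true = true
false ==ᴮ false = true
_ ==ᴮ _ = false

Word : Set
Word = List ℕ

oneTo : ℕ → List ℕ
oneTo n = map suc (upTo n)

-- w is a permutation of {1,…,n} where n = length w (this forces distinct letters)
IsPermutation : Word → Set
IsPermutation w = w ↭ oneTo (length w)

-- position of the first occurrence of a in w (length w if absent)
pos : ℕ → Word → ℕ
pos a [] = zero
pos a (b ∷ w) = if a ≡ᵇ b then zero else suc (pos a w)

iDes : Word → List ℕ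
iDes w = filterᵇ (λ i → pos (suc i) w <ᵇ pos i w) (oneTo (length w ∸ 1))

-- γ_x(v): mode m = (v₁ < x); a new block starts at each letter b with (b < x) == m;
-- the first letter of each block is moved to the end of its block.
-- go m h r : h is the (pending) first letter of the current block, r the rest.
γ-go : ℕ → Bool → ℕ → Word → Word
γ-go x m h [] = [ h ]
γ-go x m h (b ∷ r) =
  if (b <ᵇ x) ==ᴮ m then h ∷ γ-go x m b r else b ∷ γ-go x m h r

γ : ℕ → Word → Word
γ x [] = []
γ x (a ∷ r) = γ-go x (a <ᵇ x) a r

-- Whether i + 1 lies left of i is decided by any subword containing both letters.
-- If i and i + 1 are on the same side of x, take the subword of all letters on
-- that side: every block of Γₓ(v) is one letter of one side followed by letters
-- of the other, so rotating the block leaves the subword of each side unchanged.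
-- Otherwise i + 1 = x, and the order of x and i is settled within the common
-- prefix u x of the two words.
module Submission where

open import Defs
open import Data.Bool using (Bool; true; false; T)
open import Data.Bool.Properties using (T?)
open import Data.List using (List; []; _∷_; _++_; [_]; length; filterᵇ)
open import Data.List.Properties using (filter-++; filter-reject; filter-≐; length-++)
open import Data.Nat using (ℕ; zero; suc; _+_; _∸_; _<ᵇ_; _≡ᵇ_)
open import Data.Nat.Properties using (≡ᵇ⇒≡; ≡⇒≡ᵇ)
open import Data.Product using (_,_)
open import Data.Sum using (_⊎_; inj₁; inj₂)
import Data.Sum as Sum
open import Function using (_∘_; id)
open import Relation.Binary.PropositionalEquality
  using (_≡_; refl; sym; trans; cong; subst; _≗_; module ≡-Reasoning)

leftOf : ℕ → ℕ → Word → Bool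
leftOf a b w = pos a w <ᵇ pos b w

onSide : ℕ → Bool → ℕ → Bool
onSide x t y = (y <ᵇ x) ==ᴮ t

==ᴮ-refl : ∀ b → (b ==ᴮ b) ≡ true
==ᴮ-refl true = refl
==ᴮ-refl false = refl

==ᴮ⇒≡ : ∀ a b → (a ==ᴮ b) ≡ true → a ≡ b
==ᴮ⇒≡ true true _ = refl
==ᴮ⇒≡ false false _ = refl

≡⇒==ᴮ : ∀ {a b} → a ≡ b → (a ==ᴮ b) ≡ true
≡⇒==ᴮ {b = b} refl = ==ᴮ-refl b

==ᴮ-false-split : ∀ a b t → (a ==ᴮ b) ≡ false → (a ==ᴮ t) ≡ false ⊎ (b ==ᴮ t) ≡ false
==ᴮ-false-split true false true _ = inj₂ refl
==ᴮ-false-split true false false _ = inj₁ refl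
==ᴮ-false-split false true true _ = inj₁ refl
==ᴮ-false-split false true false _ = inj₂ refl

<ᵇ-suc-cases : ∀ i x → (i <ᵇ x) ≡ (suc i <ᵇ x) ⊎ suc i ≡ x
<ᵇ-suc-cases i zero = inj₁ refl
<ᵇ-suc-cases zero (suc zero) = inj₂ refl
<ᵇ-suc-cases zero (suc (suc x)) = inj₁ refl
<ᵇ-suc-cases (suc i) (suc x) = Sum.map id (cong suc) (<ᵇ-suc-cases i x)

filterᵇ-cong : ∀ {p q : ℕ → Bool} → p ≗ q → filterᵇ p ≗ filterᵇ q
filterᵇ-cong {p} {q} p≗q =
  filter-≐ (T? ∘ p) (T? ∘ q) ((λ {i} → subst T (p≗q i)) , (λ {i} → subst T (sym (p≗q i))))

filterᵇ-++⁺ʳ : ∀ (p : ℕ → Bool) u {v v'} →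
  filterᵇ p v ≡ filterᵇ p v' → filterᵇ p (u ++ v) ≡ filterᵇ p (u ++ v')
filterᵇ-++⁺ʳ p u {v} {v'} eq = begin
  filterᵇ p (u ++ v)             ≡⟨ filter-++ (T? ∘ p) u v ⟩
  filterᵇ p u ++ filterᵇ p v     ≡⟨ cong (filterᵇ p u ++_) eq ⟩
  filterᵇ p u ++ filterᵇ p v'    ≡⟨ sym (filter-++ (T? ∘ p) u v') ⟩
  filterᵇ p (u ++ v')            ∎
  where open ≡-Reasoning

filterᵇ-reject : ∀ (p : ℕ → Bool) c w → p c ≡ false → filterᵇ p (c ∷ w) ≡ filterᵇ p w
filterᵇ-reject p c w pc = filter-reject (T? ∘ p) (subst T pc)

filterᵇ-swap : ∀ (p : ℕ → Bool) b h r → p b ≡ false ⊎ p h ≡ false →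
  filterᵇ p (b ∷ h ∷ r) ≡ filterᵇ p (h ∷ b ∷ r)
filterᵇ-swap p b h r (inj₁ pb) =
  trans (filterᵇ-reject p b (h ∷ r) pb) (sym (filterᵇ-++⁺ʳ p [ h ] (filterᵇ-reject p b r pb)))
filterᵇ-swap p b h r (inj₂ ph) =
  trans (filterᵇ-++⁺ʳ p [ b ] (filterᵇ-reject p h r ph)) (sym (filterᵇ-reject p h (b ∷ r) ph))

leftOf-∷⁺ : ∀ a b c w w' → leftOf a b w ≡ leftOf a b w' →
  leftOf a b (c ∷ w) ≡ leftOf a b (c ∷ w')
leftOf-∷⁺ a b c w w' eq with a ≡ᵇ c | b ≡ᵇ c
... | true | true = refl
... | true | false = refl
... | false | true = refl
... | false | false = eq

leftOf-++⁺ : ∀ a b u w w' → leftOf a b w ≡ leftOf a b w' →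
  leftOf a b (u ++ w) ≡ leftOf a b (u ++ w')
leftOf-++⁺ a b [] w w' eq = eq
leftOf-++⁺ a b (c ∷ u) w w' eq = leftOf-∷⁺ a b c (u ++ w) (u ++ w') (leftOf-++⁺ a b u w w' eq)

leftOf-skip : ∀ a b c w → (a ≡ᵇ c) ≡ false → (b ≡ᵇ c) ≡ false →
  leftOf a b (c ∷ w) ≡ leftOf a b w
leftOf-skip a b c w a≢c b≢c with a ≡ᵇ c | b ≡ᵇ c
leftOf-skip a b c w refl refl | false | false = refl

leftOf-head : ∀ a b v v' → leftOf a b (a ∷ v) ≡ leftOf a b (a ∷ v')
leftOf-head a b v v' with a ≡ᵇ a | ≡⇒≡ᵇ a a refl
... | true | _ with b ≡ᵇ a
...   | true = refl
...   | false = refl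

distinguished⇒≡ᵇ-false : ∀ (p : ℕ → Bool) a c → p a ≡ true → p c ≡ false → (a ≡ᵇ c) ≡ false
distinguished⇒≡ᵇ-false p a c pa pc with a ≡ᵇ c in a≡c
... | false = refl
... | true with refl ← ≡ᵇ⇒≡ a c (subst T (sym a≡c) _) with () ← trans (sym pa) pc

leftOf-filterᵇ : ∀ (p : ℕ → Bool) a b → p a ≡ true → p b ≡ true →
  ∀ w → leftOf a b (filterᵇ p w) ≡ leftOf a b w
leftOf-filterᵇ p a b pa pb [] = refl
leftOf-filterᵇ p a b pa pb (c ∷ w) with p c in pc
... | true = leftOf-∷⁺ a b c (filterᵇ p w) w (leftOf-filterᵇ p a b pa pb w)
... | false = trans (leftOf-filterᵇ p a b pa pb w)
  (sym (leftOf-skip a b c w (distinguished⇒≡ᵇ-false p a c pa pc)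
                             (distinguished⇒≡ᵇ-false p b c pb pc)))

leftOf-filterᵇ-cong : ∀ (p : ℕ → Bool) a b → p a ≡ true → p b ≡ true →
  ∀ w w' → filterᵇ p w ≡ filterᵇ p w' → leftOf a b w ≡ leftOf a b w'
leftOf-filterᵇ-cong p a b pa pb w w' eq = begin
  leftOf a b w               ≡⟨ sym (leftOf-filterᵇ p a b pa pb w) ⟩
  leftOf a b (filterᵇ p w)   ≡⟨ cong (leftOf a b) eq ⟩
  leftOf a b (filterᵇ p w')  ≡⟨ leftOf-filterᵇ p a b pa pb w' ⟩
  leftOf a b w'              ∎
  where open ≡-Reasoning

filterᵇ-onSide-γ-go : ∀ x t m h r → (h <ᵇ x) ≡ m →
  filterᵇ (onSide x t) (γ-go x m h r) ≡ filterᵇ (onSide x t) (h ∷ r)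
filterᵇ-onSide-γ-go x t m h [] _ = refl
filterᵇ-onSide-γ-go x t .(h <ᵇ x) h (b ∷ r) refl with (b <ᵇ x) ==ᴮ (h <ᵇ x) in b-side
... | true = filterᵇ-++⁺ʳ (onSide x t) [ h ]
  (filterᵇ-onSide-γ-go x t (h <ᵇ x) b r (==ᴮ⇒≡ _ _ b-side))
... | false =
  trans (filterᵇ-++⁺ʳ (onSide x t) [ b ] (filterᵇ-onSide-γ-go x t (h <ᵇ x) h r refl))
  (filterᵇ-swap (onSide x t) b h r (==ᴮ-false-split (b <ᵇ x) (h <ᵇ x) t b-side))

filterᵇ-onSide-γ : ∀ x t v → filterᵇ (onSide x t) (γ x v) ≡ filterᵇ (onSide x t) v
filterᵇ-onSide-γ x t [] = refl
filterᵇ-onSide-γ x t (a ∷ r) = filterᵇ-onSide-γ-go x t (a <ᵇ x) a r refl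

length-γ-go : ∀ x m h r → length (γ-go x m h r) ≡ suc (length r)
length-γ-go x m h [] = refl
length-γ-go x m h (b ∷ r) with (b <ᵇ x) ==ᴮ m
... | true = cong suc (length-γ-go x m b r)
... | false = cong suc (length-γ-go x m h r)

length-γ : ∀ x v → length (γ x v) ≡ length v
length-γ x [] = refl
length-γ x (a ∷ r) = length-γ-go x (a <ᵇ x) a r

leftOf-suc-γ : ∀ u v x i →
  leftOf (suc i) i (u ++ x ∷ v) ≡ leftOf (suc i) i (u ++ x ∷ γ x v)
leftOf-suc-γ u v x i with <ᵇ-suc-cases i x
... | inj₂ refl =
  leftOf-++⁺ (suc i) i u (suc i ∷ v) (suc i ∷ γ x v) (leftOf-head (suc i) i v (γ x v))
... | inj₁ same-side =
  leftOf-filterᵇ-cong (onSide x (i <ᵇ x)) (suc i) i (≡⇒==ᴮ (sym same-side)) (==ᴮ-refl (i <ᵇ x))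
    (u ++ x ∷ v) (u ++ x ∷ γ x v) (filterᵇ-++⁺ʳ (onSide x (i <ᵇ x)) u
      (filterᵇ-++⁺ʳ (onSide x (i <ᵇ x)) [ x ] (sym (filterᵇ-onSide-γ x (i <ᵇ x) v))))

iDes-cong : ∀ w w' → (∀ i → leftOf (suc i) i w ≡ leftOf (suc i) i w') →
  length w ≡ length w' → iDes w ≡ iDes w'
iDes-cong w w' same-order same-length =
  trans (filterᵇ-cong same-order (oneTo (length w ∸ 1)))
        (cong (λ n → filterᵇ (λ i → leftOf (suc i) i w') (oneTo (n ∸ 1))) same-length)

proposition4p1 : (u v : Word) (x : ℕ) →
    IsPermutation (u ++ x ∷ v) →
    iDes (u ++ x ∷ v) ≡ iDes (u ++ x ∷ γ x v)
proposition4p1 u v x _ = iDes-cong (u ++ x ∷ v) (u ++ x ∷ γ x v) (leftOf-suc-γ u v x) (begin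
  length (u ++ x ∷ v)              ≡⟨ length-++ u ⟩
  length u + suc (length v)        ≡⟨ cong (λ n → length u + suc n) (sym (length-γ x v)) ⟩
  length u + suc (length (γ x v))  ≡⟨ sym (length-++ u) ⟩
  length (u ++ x ∷ γ x v)          ∎)
  where open ≡-Reasoning
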